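{- For every prime power $q$ there exists a set $E\subset\mathbb{F}_q^2$ with $|E|\approx q^2$ such that no pair of vectors of $E$ is orthogonal, i.e. there are no $x,y\in E$ with $x\cdot y=0$.
   Context: $x\cdot y=x_1y_1+x_2y_2$ is the standard dot product on $\mathbb{F}_q^2$. $|E|\approx q^2$ means $c q^2\le |E|\le C q^2$ for constants $c,C>0$ independent of $q$. -}

module Defs where

open import Data.Nat using (ℕ)
open import Data.Fin using (Fin)
open import Data.Product using (_×_; _,_; ∃)
open import Relation.Binary.PropositionalEquality using (_≡_; _≢_)
open import Algebra.Structures using (IsCommutativeRing)

-- Every finite field of order q is isomorphic to one of this form, and
-- such a structure exists iff q is a prime power.
record FiniteField (q : ℕ) : Set where
  infixl 6 _+_
  infixl 7 _*_
  field
    _+_ _*_ : Fin q → Fin q → Fin q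
    -_ : Fin q → Fin q
    0# 1# : Fin q
    isCommutativeRing : IsCommutativeRing _≡_ _+_ _*_ -_ 0# 1#
    0≢1 : 0# ≢ 1#
    inverse : ∀ x → x ≢ 0# → ∃ λ y → x * y ≡ 1#

dot : ∀ {q} → FiniteField q → Fin q × Fin q → Fin q × Fin q → Fin q
dot F (x₁ , x₂) (y₁ , y₂) = x₁ * y₁ + x₂ * y₂
  where open FiniteField F

module Submission where

open import Defs
open import Data.Nat using (ℕ; _≤_; _*_)
open import Data.Fin using (Fin)
open import Data.Product using (_×_; ∃; Σ)
open import Data.List using (List; length)
open import Data.List.Membership.Propositional using (_∈_)
open import Data.List.Relation.Unary.Unique.Propositional using (Unique)
open import Relation.Binary.PropositionalEquality using (_≢_)

import Data.Nat as ℕ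
open import Data.Nat using (_<_; z≤n)
import Data.Nat.Properties as ℕₚ
open import Data.Nat.Tactic.RingSolver using (solve-∀)
open import Data.Fin using (toℕ)
import Data.Fin.Properties as Fin
open import Data.Product using (_,_; proj₁; proj₂)
open import Data.Sum using (_⊎_; inj₁; inj₂)
open import Data.Empty using (⊥; ⊥-elim)
open import Data.List using ([]; _∷_; _++_; map; filter; allFin; cartesianProduct; lookup)
open import Data.List.Relation.Unary.All as All using (All; []; _∷_)
open import Data.List.Relation.Unary.AllPairs using ([]; _∷_)
open import Data.List.Relation.Unary.Any using (here; there; index)
import Data.List.Relation.Unary.Any.Properties as Any
import Data.List.Relation.Unary.All.Properties as All
import Data.List.Properties as List
import Data.List.Membership.Propositional.Properties as ∈
import Data.List.Relation.Unary.Unique.Propositional.Properties as Unique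
open import Relation.Nullary using (¬_; Dec; yes; no)
open import Relation.Nullary.Decidable using (¬?; _×-dec_; _→-dec_)
open import Relation.Binary.PropositionalEquality
  using (_≡_; refl; sym; trans; cong; cong₂; subst; module ≡-Reasoning)
open import Relation.Binary.Definitions using (tri<; tri≈; tri>)
open import Algebra.Bundles using (CommutativeRing)
import Algebra.Properties.Group as GroupProperties
import Algebra.Properties.Ring as RingProperties

-- For a slope t ∈ F_q put ℓ_t = {(a , a t) : a ≠ 0}.  Since
--   (a , a t) · (a' , a' t') = a a' (1 + t t'),
-- the set E = ⋃_{t ∈ T} ℓ_t has no orthogonal pair as soon as the slopes in
-- T are pairwise non-orthogonal, i.e. 1 + t t' ≠ 0 for all t, t' ∈ T
-- (t = t' included).  Orthogonality of slopes, t ⟂ s :⇔ 1 + t s = 0, is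
-- symmetric and every slope has at most one partner (s ↦ -1/s).  Choosing
-- greedily (in the order of Fin q) the slopes that are not self-orthogonal
-- and have no smaller partner gives such a T, and every slope is either in
-- T, a partner of an element of T, or one of the at most two roots of
-- 1 + t² = 0; hence q ≤ 2|T| + 2 ≤ 4|T|.  With |E| = (q - 1)|T| this yields
-- q² ≤ 8|E| and trivially |E| ≤ q².

≤length-by-injective-placement :
  ∀ {q} {B : Set} (ys : List B) (R : Fin q → B → Set) →
  (∀ t → Σ B λ b → b ∈ ys × R t b) →
  (∀ {t t' b} → R t b → R t' b → t ≡ t') →
  q ≤ length ys
≤length-by-injective-placement {q} ys R place functional =
  Fin.injective⇒≤ position-injective
  where
  position : Fin q → Fin (length ys)
  position t = index (proj₁ (proj₂ (place t)))

  member-at : ∀ t → proj₁ (place t) ≡ lookup ys (position t)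
  member-at t = Any.lookup-index (proj₁ (proj₂ (place t)))

  position-injective : ∀ {t t'} → position t ≡ position t' → t ≡ t'
  position-injective {t} {t'} same = functional (proj₂ (proj₂ (place t))) R-t'
    where
    same-member : proj₁ (place t') ≡ proj₁ (place t)
    same-member = trans (member-at t') (trans (cong (lookup ys) (sym same)) (sym (member-at t)))
    R-t' : R t' (proj₁ (place t))
    R-t' = subst (R t') same-member (proj₂ (proj₂ (place t')))

length-cartesianProduct : ∀ {A B : Set} (xs : List A) (ys : List B) →
                          length (cartesianProduct xs ys) ≡ length xs * length ys
length-cartesianProduct [] ys = refl
length-cartesianProduct (x ∷ xs) ys = begin
    length (map (x ,_) ys ++ cartesianProduct xs ys)
  ≡⟨ List.length-++ (map (x ,_) ys) ⟩
    length (map (x ,_) ys) ℕ.+ length (cartesianProduct xs ys)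
  ≡⟨ cong₂ ℕ._+_ (List.length-map (x ,_) ys) (length-cartesianProduct xs ys) ⟩
    length ys ℕ.+ length xs * length ys ∎
  where open ≡-Reasoning

map-injectiveOn⁺ : ∀ {A B : Set} {P : A → Set} {f : A → B} →
                   (∀ {x y} → P x → P y → f x ≡ f y → x ≡ y) →
                   ∀ {xs} → All P xs → Unique xs → Unique (map f xs)
map-injectiveOn⁺ inj [] [] = []
map-injectiveOn⁺ {P = P} {f = f} inj {x ∷ _} (px ∷ pxs) (x∉xs ∷ xs!) =
  All.map⁺ (All.zipWith f-separates (pxs , x∉xs)) ∷ map-injectiveOn⁺ inj pxs xs!
  where
  f-separates : ∀ {y} → P y × x ≢ y → f x ≢ f y
  f-separates (py , x≢y) fx≡fy = x≢y (inj px py fx≡fy)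

square-≤-8* : ∀ q m n → q ≤ 2 * m → q ≤ 4 * n → q * q ≤ 8 * (m * n)
square-≤-8* q m n q≤2m q≤4n = begin
  q * q              ≤⟨ ℕₚ.*-mono-≤ q≤2m q≤4n ⟩
  (2 * m) * (4 * n)  ≡⟨ regroup m n ⟩
  8 * (m * n)        ∎
  where
  open ℕₚ.≤-Reasoning
  regroup : ∀ m n → (2 * m) * (4 * n) ≡ 8 * (m * n)
  regroup = solve-∀

module NonOrthogonalSet {q : ℕ} (F : FiniteField q) where
  open FiniteField F renaming (_*_ to _·_)

  commutativeRing : CommutativeRing _ _
  commutativeRing = record { isCommutativeRing = isCommutativeRing }
  open CommutativeRing commutativeRing
    using (*-assoc; *-comm; *-identityˡ; zeroˡ; zeroʳ; +-identityʳ; -‿inverseʳ; +-group)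
  open GroupProperties +-group using (∙-cancelˡ; ∙-cancelʳ; inverseˡ-unique; x∙y⁻¹≈ε⇒x≈y)
  open RingProperties (CommutativeRing.ring commutativeRing) using (-1*x≈-x)
  open import Algebra.Solver.Ring.NaturalCoefficients.Default
    (CommutativeRing.commutativeSemiring commutativeRing)

  _≟_ : (x y : Fin q) → Dec (x ≡ y)
  _≟_ = Fin._≟_

  1≢0 : 1# ≢ 0#
  1≢0 1≡0 = 0≢1 (sym 1≡0)

  *-cancelˡ : ∀ {a x y} → a ≢ 0# → a · x ≡ a · y → x ≡ y
  *-cancelˡ {a} {x} {y} a≢0 ax≡ay with inverse a a≢0
  ... | b , ab≡1 = begin
      x            ≡⟨ sym (*-identityˡ x) ⟩
      1# · x       ≡⟨ cong (_· x) (sym ba≡1) ⟩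
      (b · a) · x  ≡⟨ *-assoc b a x ⟩
      b · (a · x)  ≡⟨ cong (b ·_) ax≡ay ⟩
      b · (a · y)  ≡⟨ sym (*-assoc b a y) ⟩
      (b · a) · y  ≡⟨ cong (_· y) ba≡1 ⟩
      1# · y       ≡⟨ *-identityˡ y ⟩
      y            ∎
    where
    open ≡-Reasoning
    ba≡1 : b · a ≡ 1#
    ba≡1 = trans (*-comm b a) ab≡1

  *-cancelʳ : ∀ {a x y} → a ≢ 0# → x · a ≡ y · a → x ≡ y
  *-cancelʳ {a} {x} {y} a≢0 xa≡ya = *-cancelˡ a≢0 (trans (*-comm a x) (trans xa≡ya (*-comm y a)))

  noZeroDivisors : ∀ a b → a · b ≡ 0# → a ≡ 0# ⊎ b ≡ 0#
  noZeroDivisors a b ab≡0 with a ≟ 0#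
  ... | yes a≡0 = inj₁ a≡0
  ... | no a≢0 = inj₂ (*-cancelˡ a≢0 (trans ab≡0 (sym (zeroʳ a))))

  -- t² = u² forces t = ±u, since (t - u)(t + u) = t² - u².
  squares-equal : ∀ t u → t · t ≡ u · u → t ≡ u ⊎ t ≡ - u
  squares-equal t u t²≡u² with noZeroDivisors (t + - 1# · u) (t + u) product≡0
    where
    open ≡-Reasoning
    -- the semiring identity (t + n u)(t + u) + u² = (1 + n)(u² + t u) + t², at n = -1
    expand : ∀ t u n → (t + n · u) · (t + u) + u · u ≡ (1# + n) · (u · u + t · u) + t · t
    expand = solve 3 (λ t u n → (t :+ n :* u) :* (t :+ u) :+ u :* u
                              := (con 1 :+ n) :* (u :* u :+ t :* u) :+ t :* t) refl
    product≡0 : (t + - 1# · u) · (t + u) ≡ 0#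
    product≡0 = ∙-cancelʳ (u · u) _ _ (begin
      (t + - 1# · u) · (t + u) + u · u           ≡⟨ expand t u (- 1#) ⟩
      (1# + - 1#) · (u · u + t · u) + t · t      ≡⟨ cong (λ z → z · (u · u + t · u) + t · t) (-‿inverseʳ 1#) ⟩
      0# · (u · u + t · u) + t · t               ≡⟨ cong (_+ t · t) (zeroˡ _) ⟩
      0# + t · t                                 ≡⟨ cong (0# +_) t²≡u² ⟩
      0# + u · u                                 ∎)
  ... | inj₁ t-u≡0 = inj₁ (x∙y⁻¹≈ε⇒x≈y t u (subst (λ z → t + z ≡ 0#) (-1*x≈-x u) t-u≡0))
  ... | inj₂ t+u≡0 = inj₂ (inverseˡ-unique t u t+u≡0)

  -- Orthogonality of slopes: (1 , t) · (1 , s) = 1 + t s.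

  infix 4 _⟂_
  _⟂_ : Fin q → Fin q → Set
  t ⟂ s = 1# + t · s ≡ 0#

  _⟂?_ : ∀ t s → Dec (t ⟂ s)
  t ⟂? s = (1# + t · s) ≟ 0#

  ⟂-sym : ∀ {t s} → t ⟂ s → s ⟂ t
  ⟂-sym {t} {s} = subst (λ z → 1# + z ≡ 0#) (*-comm t s)

  ⟂⇒≢0 : ∀ {t s} → t ⟂ s → s ≢ 0#
  ⟂⇒≢0 {t} t⟂s s≡0 = 1≢0 (begin
    1#           ≡⟨ sym (+-identityʳ 1#) ⟩
    1# + 0#      ≡⟨ cong (1# +_) (sym (trans (cong (t ·_) s≡0) (zeroʳ t))) ⟩
    1# + t · _   ≡⟨ t⟂s ⟩
    0#           ∎)
    where open ≡-Reasoning

  ⟂-unique : ∀ {t t' s} → t ⟂ s → t' ⟂ s → t ≡ t'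
  ⟂-unique t⟂s t'⟂s = *-cancelʳ (⟂⇒≢0 t⟂s) (∙-cancelˡ 1# _ _ (trans t⟂s (sym t'⟂s)))

  -- The self-orthogonal slopes (roots of 1 + t² = 0) are at most two: once
  -- one root t₀ is found, every root is ±t₀.
  selfOrthogonalFrom : Dec (∃ λ t → t ⟂ t) → List (Fin q)
  selfOrthogonalFrom (yes (t₀ , _)) = t₀ ∷ - t₀ ∷ []
  selfOrthogonalFrom (no _) = []

  selfOrthogonal? : Dec (∃ λ t → t ⟂ t)
  selfOrthogonal? = Fin.any? (λ t → t ⟂? t)

  selfOrthogonal : List (Fin q)
  selfOrthogonal = selfOrthogonalFrom selfOrthogonal?

  ∈-selfOrthogonalFrom : ∀ d {t} → t ⟂ t → t ∈ selfOrthogonalFrom d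
  ∈-selfOrthogonalFrom (yes (t₀ , t₀⟂t₀)) {t} t⟂t
    with squares-equal t t₀ (∙-cancelˡ 1# _ _ (trans t⟂t (sym t₀⟂t₀)))
  ... | inj₁ t≡t₀ = here t≡t₀
  ... | inj₂ t≡-t₀ = there (here t≡-t₀)
  ∈-selfOrthogonalFrom (no none) {t} t⟂t = ⊥-elim (none (t , t⟂t))

  length-selfOrthogonalFrom : ∀ d → length (selfOrthogonalFrom d) ≤ 2
  length-selfOrthogonalFrom (yes _) = ℕₚ.≤-refl
  length-selfOrthogonalFrom (no _) = z≤n

  Representative : Fin q → Set
  Representative t = ¬ t ⟂ t × (∀ s → toℕ s < toℕ t → ¬ t ⟂ s)

  representative? : ∀ t → Dec (Representative t)
  representative? t = ¬? (t ⟂? t)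
    ×-dec Fin.all? (λ s → (toℕ s ℕₚ.<? toℕ t) →-dec ¬? (t ⟂? s))

  T : List (Fin q)
  T = filter representative? (allFin q)

  ∈T⁺ : ∀ {t} → Representative t → t ∈ T
  ∈T⁺ {t} = ∈.∈-filter⁺ representative? (∈.∈-allFin t)

  ∈T⁻ : ∀ {t} → t ∈ T → Representative t
  ∈T⁻ t∈T = proj₂ (∈.∈-filter⁻ representative? {xs = allFin q} t∈T)

  representatives-not-⟂ : ∀ {t t'} → Representative t → Representative t' → ¬ t ⟂ t'
  representatives-not-⟂ {t} {t'} (¬t⟂t , t-minimal) (_ , t'-minimal) t⟂t'
    with ℕₚ.<-cmp (toℕ t) (toℕ t')
  ... | tri< t<t' _ _ = t'-minimal t t<t' (⟂-sym t⟂t')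
  ... | tri> _ _ t'<t = t-minimal t' t'<t t⟂t'
  ... | tri≈ _ t≡t' _ with Fin.toℕ-injective t≡t'
  ...   | refl = ¬t⟂t t⟂t'

  -- A partner of smaller index is itself a representative: its own smaller
  -- partner could only be t again (uniqueness of partners).
  smaller-partner-representative : ∀ {t s} → toℕ s < toℕ t → t ⟂ s → Representative s
  smaller-partner-representative {t} {s} s<t t⟂s = ¬s⟂s , s-minimal
    where
    ¬s⟂s : ¬ s ⟂ s
    ¬s⟂s s⟂s = ℕₚ.<-irrefl (cong toℕ (⟂-unique s⟂s t⟂s)) s<t
    s-minimal : ∀ r → toℕ r < toℕ s → ¬ s ⟂ r
    s-minimal r r<s s⟂r = ℕₚ.<-asym s<t
      (subst (λ z → toℕ z < toℕ s) (⟂-unique (⟂-sym s⟂r) t⟂s) r<s)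

  -- Every slope is a representative, self-orthogonal, or the partner of a
  -- representative; hence q ≤ 2|T| + 2.
  data Placement : Set where
    itself : Fin q → Placement
    partnerOf : Fin q → Placement

  PlacedAt : Fin q → Placement → Set
  PlacedAt t (itself x) = x ≡ t
  PlacedAt t (partnerOf s) = t ⟂ s

  placements : List Placement
  placements = map itself (T ++ selfOrthogonal) ++ map partnerOf T

  place : ∀ t → Σ Placement λ b → b ∈ placements × PlacedAt t b
  place t with representative? t | t ⟂? t
  ... | yes rep | _ = itself t , ∈.∈-++⁺ˡ (∈.∈-map⁺ itself (∈.∈-++⁺ˡ (∈T⁺ rep))) , refl
  ... | no _ | yes t⟂t = itself t ,
    ∈.∈-++⁺ˡ (∈.∈-map⁺ itself (∈.∈-++⁺ʳ T (∈-selfOrthogonalFrom selfOrthogonal? t⟂t))) , refl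
  ... | no ¬rep | no ¬t⟂t with Fin.any? (λ s → (toℕ s ℕₚ.<? toℕ t) ×-dec (t ⟂? s))
  ...   | no none = ⊥-elim (¬rep (¬t⟂t , λ s s<t t⟂s → none (s , s<t , t⟂s)))
  ...   | yes (s , s<t , t⟂s) = partnerOf s ,
    ∈.∈-++⁺ʳ _ (∈.∈-map⁺ partnerOf (∈T⁺ (smaller-partner-representative s<t t⟂s))) , t⟂s

  placedAt-functional : ∀ {t t' b} → PlacedAt t b → PlacedAt t' b → t ≡ t'
  placedAt-functional {b = itself x} refl refl = refl
  placedAt-functional {b = partnerOf s} t⟂s t'⟂s = ⟂-unique t⟂s t'⟂s

  length-placements : length placements ≡ (length T ℕ.+ length selfOrthogonal) ℕ.+ length T
  length-placements = begin
    length placements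
      ≡⟨ List.length-++ (map itself (T ++ selfOrthogonal)) ⟩
    length (map itself (T ++ selfOrthogonal)) ℕ.+ length (map partnerOf T)
      ≡⟨ cong₂ ℕ._+_ (List.length-map itself (T ++ selfOrthogonal)) (List.length-map partnerOf T) ⟩
    length (T ++ selfOrthogonal) ℕ.+ length T
      ≡⟨ cong (ℕ._+ length T) (List.length-++ T) ⟩
    (length T ℕ.+ length selfOrthogonal) ℕ.+ length T ∎
    where open ≡-Reasoning

  0∈T : 0# ∈ T
  0∈T = ∈T⁺ ((λ 0⟂0 → 1≢0 (trans (sym (one-plus-zero 0#)) 0⟂0)) ,
             (λ s _ 0⟂s → 1≢0 (trans (sym (one-plus-zero s)) 0⟂s)))
    where
    one-plus-zero : ∀ s → 1# + 0# · s ≡ 1#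
    one-plus-zero s = trans (cong (1# +_) (zeroˡ s)) (+-identityʳ 1#)

  q≤4|T| : q ≤ 4 * length T
  q≤4|T| = begin
    q                      ≤⟨ ≤length-by-injective-placement placements PlacedAt place placedAt-functional ⟩
    length placements      ≡⟨ length-placements ⟩
    (n ℕ.+ s) ℕ.+ n        ≤⟨ ℕₚ.+-monoˡ-≤ n (ℕₚ.+-monoʳ-≤ n s≤n+n) ⟩
    (n ℕ.+ (n ℕ.+ n)) ℕ.+ n  ≡⟨ regroup n ⟩
    4 * n                  ∎
    where
    open ℕₚ.≤-Reasoning
    n = length T
    s = length selfOrthogonal
    -- 0 ∈ T, so the (at most two) self-orthogonal slopes number at most 2|T|
    s≤n+n : s ≤ n ℕ.+ n
    s≤n+n = ℕₚ.≤-trans (length-selfOrthogonalFrom selfOrthogonal?) (ℕₚ.+-mono-≤ (∈.∈-length 0∈T) (∈.∈-length 0∈T))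
    regroup : ∀ n → (n ℕ.+ (n ℕ.+ n)) ℕ.+ n ≡ 4 * n
    regroup = solve-∀

  A : List (Fin q)
  A = filter (λ a → ¬? (a ≟ 0#)) (allFin q)

  ∈A⁺ : ∀ {a} → a ≢ 0# → a ∈ A
  ∈A⁺ {a} = ∈.∈-filter⁺ (λ a → ¬? (a ≟ 0#)) (∈.∈-allFin a)

  ∈A⁻ : ∀ {a} → a ∈ A → a ≢ 0#
  ∈A⁻ a∈A = proj₂ (∈.∈-filter⁻ (λ a → ¬? (a ≟ 0#)) {xs = allFin q} a∈A)

  q≤2|A| : q ≤ 2 * length A
  q≤2|A| = begin
    q                ≤⟨ ≤length-by-injective-placement (0# ∷ A) (λ t a → a ≡ t) (λ t → t , covered t , refl)
                          (λ { refl refl → refl }) ⟩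
    1 ℕ.+ m          ≤⟨ ℕₚ.+-monoˡ-≤ m (∈.∈-length (∈A⁺ 1≢0)) ⟩
    m ℕ.+ m          ≡⟨ regroup m ⟩
    2 * m            ∎
    where
    open ℕₚ.≤-Reasoning
    m = length A
    regroup : ∀ m → m ℕ.+ m ≡ 2 * m
    regroup = solve-∀
    covered : ∀ t → t ∈ 0# ∷ A
    covered t with t ≟ 0#
    ... | yes t≡0 = here t≡0
    ... | no t≢0 = there (∈A⁺ t≢0)

  onLine : Fin q × Fin q → Fin q × Fin q
  onLine (a , t) = a , a · t

  E : List (Fin q × Fin q)
  E = map onLine (cartesianProduct A T)

  ∈E⁻ : ∀ {x} → x ∈ E → ∃ λ a → ∃ λ t → a ∈ A × t ∈ T × x ≡ (a , a · t)
  ∈E⁻ x∈E with ∈.∈-map⁻ onLine x∈E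
  ... | (a , t) , at∈A×T , refl with ∈.∈-cartesianProduct⁻ A T at∈A×T
  ...   | a∈A , t∈T = a , t , a∈A , t∈T , refl

  dot-onLine : ∀ a a' t t' → dot F (a , a · t) (a' , a' · t') ≡ (a · a') · (1# + t · t')
  dot-onLine = solve 4 (λ a a' t t' → a :* a' :+ (a :* t) :* (a' :* t')
                                    := (a :* a') :* (con 1 :+ t :* t')) refl

  -- a ↦ (a , a t) is injective for a ≠ 0, so E has no repetitions.
  E-unique : Unique E
  E-unique = map-injectiveOn⁺ onLine-injective
    (All.tabulate (λ at∈A×T → ∈A⁻ (proj₁ (∈.∈-cartesianProduct⁻ A T at∈A×T))))
    (Unique.cartesianProduct⁺ (Unique.filter⁺ _ (Unique.allFin⁺ q)) (Unique.filter⁺ _ (Unique.allFin⁺ q)))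
    where
    onLine-injective : ∀ {x y} → proj₁ x ≢ 0# → proj₁ y ≢ 0# → onLine x ≡ onLine y → x ≡ y
    onLine-injective {a , t} {a' , t'} a≢0 _ same with cong proj₁ same
    ... | refl = cong (a ,_) (*-cancelˡ a≢0 (cong proj₂ same))

  length-E : length E ≡ length A * length T
  length-E = trans (List.length-map onLine (cartesianProduct A T)) (length-cartesianProduct A T)

  -- x · y = a a' (1 + t t') with a, a' ≠ 0 and t, t' ∈ T not orthogonal.
  E-nonOrthogonal : ∀ x y → x ∈ E → y ∈ E → dot F x y ≢ 0#
  E-nonOrthogonal x y x∈E y∈E with ∈E⁻ x∈E | ∈E⁻ y∈E
  ... | a , t , a∈A , t∈T , refl | a' , t' , a'∈A , t'∈T , refl = λ dot≡0
    → excluded (noZeroDivisors (a · a') (1# + t · t') (trans (sym (dot-onLine a a' t t')) dot≡0))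
    where
    excluded : a · a' ≡ 0# ⊎ t ⟂ t' → ⊥
    excluded (inj₂ t⟂t') = representatives-not-⟂ (∈T⁻ t∈T) (∈T⁻ t'∈T) t⟂t'
    excluded (inj₁ aa'≡0) with noZeroDivisors a a' aa'≡0
    ... | inj₁ a≡0 = ∈A⁻ a∈A a≡0
    ... | inj₂ a'≡0 = ∈A⁻ a'∈A a'≡0

  E-large : q * q ≤ 8 * length E
  E-large = subst (λ z → q * q ≤ 8 * z) (sym length-E) (square-≤-8* q (length A) (length T) q≤2|A| q≤4|T|)

  E-small : length E ≤ 1 * (q * q)
  E-small = subst (length E ≤_) (sym (ℕₚ.*-identityˡ (q * q)))
    (subst (_≤ q * q) (sym length-E) (ℕₚ.*-mono-≤ (filter≤q _) (filter≤q _)))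
    where
    filter≤q : ∀ {P : Fin q → Set} (P? : ∀ t → Dec (P t)) → length (filter P? (allFin q)) ≤ q
    filter≤q P? = ℕₚ.≤-trans (List.length-filter P? (allFin q)) (ℕₚ.≤-reflexive (List.length-tabulate (λ t → t)))

lemma3p1 : ∃ λ (k : ℕ) → ∃ λ (C : ℕ) →
    ∀ (q : ℕ) (F : FiniteField q) →
    Σ (List (Fin q × Fin q)) λ E →
    Unique E
    × q * q ≤ k * length E
    × length E ≤ C * (q * q)
    × (∀ x y → x ∈ E → y ∈ E → dot F x y ≢ FiniteField.0# F)
lemma3p1 = 8 , 1 , λ q F →
  let open NonOrthogonalSet F in E , E-unique , E-large , E-small , E-nonOrthogonal
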